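{- Let $V=(v_1,\dots,v_D)$ be a non-increasing sequence of positive integers. If $\mathcal T$ is a $V$-regular rooted tree of depth $k$, then $\mathcal T$ is isomorphic to $\mathcal T_V^k$.
   Context: Rooted trees are directed with all edges pointing toward the root; depth is the maximal distance from a vertex to the root. In a directed graph, $c$ is a predecessor of $b$ if $b$ is reachable from $c$, and $c$ is a $k$-distant predecessor of $b$ if $c$ is at distance $k$ from $b$. Set $v_i=v_D$ for all $i\ge D+1$. A directed graph is $V$-regular if for each positive integer $k$, the number of $k$-distant predecessors of any vertex is either $0$ or $v_1\cdots v_k$. Notation: $\bullet$ is the one-vertex tree; $\oplus$ is disjoint union; $k\times\mathcal G$ is the disjoint union of $k$ copies of $\mathcal G$; $\langle\mathcal T_1\oplus\cdots\oplus\mathcal T_s\rangle$ is the rooted tree whose root has children that are roots of copies of $\mathcal T_1,\dots,\mathcal T_s$. Define $\mathcal T_V^0=\bullet$ and, for $k\ge1$, $\mathcal T_V^k=\big\langle v_k\times\mathcal T_V^{k-1}\oplus\bigoplus_{i=1}^{k-1}(v_i-v_{i+1})\times\mathcal T_V^{i-1}\big\rangle$. -}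

module Defs where

open import Data.Nat using (ℕ; zero; suc; _+_; _*_; _∸_; _⊔_; _≤_)
open import Data.List using (List; []; _∷_; _++_; replicate)
open import Data.List.Relation.Binary.Permutation.Propositional using (_↭_)
open import Data.List.Relation.Binary.Pointwise using (Pointwise)
open import Data.Vec using (Vec; []; _∷_)
open import Data.Sum using (_⊎_)
open import Relation.Binary.PropositionalEquality using (_≡_)

-- Finite rooted trees: a root together with the (unordered, handled by the
-- isomorphism relation below) list of subtrees hanging from its children.
-- Edges point from each child to its parent (toward the root).
data Tree : Set where
  node : List Tree → Tree

• : Tree
• = node []

data _≅_ : Tree → Tree → Set where
  iso : ∀ {ts ws us} → ts ↭ ws → Pointwise _≅_ ws us → node ts ≅ node us

mutual
  depth : Tree → ℕ
  depth (node []) = 0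
  depth (node (t ∷ ts)) = suc (depthL (t ∷ ts))

  depthL : List Tree → ℕ
  depthL [] = 0
  depthL (t ∷ ts) = depth t ⊔ depthL ts

-- Vertices of a tree, each represented by the subtree rooted at it
-- (the list has one entry per vertex).
mutual
  vertices : Tree → List Tree
  vertices (node ts) = node ts ∷ verticesL ts

  verticesL : List Tree → List Tree
  verticesL [] = []
  verticesL (t ∷ ts) = vertices t ++ verticesL ts

-- Number of k-distant predecessors of the root of a tree, i.e. the number
-- of vertices at distance k from the root.
mutual
  distPreds : ℕ → Tree → ℕ
  distPreds zero _ = 1
  distPreds (suc k) (node ts) = distPredsL k ts

  distPredsL : ℕ → List Tree → ℕ
  distPredsL k [] = 0
  distPredsL k (t ∷ ts) = distPreds k t + distPredsL k ts

-- V = (v_1,…,v_D) with D ≥ 1 is a Vec ℕ (suc D) (v_1 is the head).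
-- vAt V i = v_i for i ≥ 1, with v_i = v_D for i ≥ D+1.
-- (vAt V 0 is a junk value and is never used.)
vAt : ∀ {D} → Vec ℕ (suc D) → ℕ → ℕ
vAt (x ∷ []) _ = x
vAt (x ∷ y ∷ xs) zero = x
vAt (x ∷ y ∷ xs) (suc zero) = x
vAt (x ∷ y ∷ xs) (suc (suc i)) = vAt (y ∷ xs) (suc i)

prodV : ∀ {D} → Vec ℕ (suc D) → ℕ → ℕ
prodV V zero = 1
prodV V (suc k) = prodV V k * vAt V (suc k)

data _∈V_ (b : Tree) : List Tree → Set where
  here  : ∀ {ts} → b ∈V (b ∷ ts)
  there : ∀ {t ts} → b ∈V ts → b ∈V (t ∷ ts)

Regular : ∀ {D} → Vec ℕ (suc D) → Tree → Set
Regular V T = ∀ b → b ∈V vertices T → ∀ k → 1 ≤ k →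
  (distPreds k b ≡ 0) ⊎ (distPreds k b ≡ prodV V k)

mutual
  TV : ∀ {D} → Vec ℕ (suc D) → ℕ → Tree
  TV V zero = •
  TV V (suc k) = node (replicate (vAt V (suc k)) (TV V k) ++ extra V k)

  extra : ∀ {D} → Vec ℕ (suc D) → ℕ → List Tree
  extra V zero = []
  extra V (suc k) = extra V k ++ replicate (vAt V (suc k) ∸ vAt V (suc (suc k))) (TV V k)

-- Every child subtree of a V-regular tree is V-regular, so by induction a child of
-- depth d is isomorphic to T_V^d; it remains to count children by depth. A V-regular
-- tree of depth ≥ m has exactly v_1⋯v_m vertices at distance m, so the root of T has
-- v_1⋯v_(m+1) = (v_1⋯v_m)·N_m vertices at distance m+1, where N_m is the number of
-- children of depth ≥ m. Hence N_m = v_(m+1) for m < depth T, and the number of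
-- children of depth exactly m is N_m − N_(m+1) = v_(m+1) − v_(m+2) for m < depth T − 1,
-- and v_(depth T) for the deepest ones: precisely the children of T_V^(depth T).
module Submission where

open import Defs
open import Data.Nat using (ℕ; suc; _≤_)
open import Data.Fin using (Fin; inject₁)
open import Data.Vec using (Vec; lookup)
open import Relation.Binary.PropositionalEquality using (_≡_)

open import Data.Nat using (zero; _+_; _*_; _∸_; _<_; z≤n; s≤s; _≟_; _≤?_; >-nonZero)
open import Data.Nat.Properties
open import Data.List using (List; []; _∷_; _++_; replicate)
open import Data.List.Relation.Unary.All using (All; []; _∷_)
open import Data.List.Relation.Binary.Pointwise using (Pointwise; []; _∷_)
open import Data.List.Relation.Binary.Permutation.Propositional
  using (_↭_; refl; prep; swap; trans; ↭-sym)
open import Data.List.Relation.Binary.Permutation.Propositional.Properties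
  using (shift; ++⁺ʳ; ++-comm)
open import Data.Vec using ([]; _∷_)
open import Data.Product using (∃; _×_; _,_)
open import Data.Sum using (inj₁; inj₂)
open import Data.Empty using (⊥-elim)
open import Relation.Nullary using (yes; no)
open import Relation.Binary using (tri<; tri≈; tri>)
open import Relation.Binary.PropositionalEquality
  using (_≢_; sym; cong; cong₂; subst; module ≡-Reasoning)
  renaming (refl to ≡-refl; trans to ≡-trans)

↭-Pointwise-commute : ∀ {A : Set} {R : A → A → Set} {xs ys zs : List A} →
  Pointwise R xs ys → ys ↭ zs → ∃ λ ws → xs ↭ ws × Pointwise R ws zs
↭-Pointwise-commute {xs = xs} rs refl = xs , refl , rs
↭-Pointwise-commute (r ∷ rs) (prep _ p) with ↭-Pointwise-commute rs p
... | _ , q , rs′ = _ , prep _ q , r ∷ rs′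
↭-Pointwise-commute (r₁ ∷ r₂ ∷ rs) (swap _ _ p) with ↭-Pointwise-commute rs p
... | _ , q , rs′ = _ , swap _ _ q , r₂ ∷ r₁ ∷ rs′
↭-Pointwise-commute rs (trans p q) with ↭-Pointwise-commute rs p
... | _ , p′ , rs′ with ↭-Pointwise-commute rs′ q
... | _ , q′ , rs″ = _ , trans p′ q′ , rs″

infix 4 _≅ᶠ_
_≅ᶠ_ : List Tree → List Tree → Set
ts ≅ᶠ us = ∃ λ ws → ts ↭ ws × Pointwise _≅_ ws us

node-cong : ∀ {ts us} → ts ≅ᶠ us → node ts ≅ node us
node-cong (_ , p , rs) = iso p rs

≅ᶠ-[] : [] ≅ᶠ []
≅ᶠ-[] = [] , refl , []

≅ᶠ-∷ : ∀ {t u ts us} → t ≅ u → ts ≅ᶠ us → t ∷ ts ≅ᶠ u ∷ us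
≅ᶠ-∷ r (_ , p , rs) = _ , prep _ p , r ∷ rs

≅ᶠ-↭ : ∀ {ts us vs} → ts ≅ᶠ us → us ↭ vs → ts ≅ᶠ vs
≅ᶠ-↭ (_ , p , rs) q with ↭-Pointwise-commute rs q
... | _ , p′ , rs′ = _ , trans p p′ , rs′

∈V-++ˡ : ∀ {b} xs {ys} → b ∈V xs → b ∈V (xs ++ ys)
∈V-++ˡ (_ ∷ _)  here      = here
∈V-++ˡ (_ ∷ xs) (there p) = there (∈V-++ˡ xs p)

∈V-++ʳ : ∀ {b} xs {ys} → b ∈V ys → b ∈V (xs ++ ys)
∈V-++ʳ []       p = p
∈V-++ʳ (_ ∷ xs) p = there (∈V-++ʳ xs p)

root∈vertices : ∀ t → t ∈V vertices t
root∈vertices (node _) = here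

mutual
  distPreds-pos : ∀ m t → m ≤ depth t → 0 < distPreds m t
  distPreds-pos zero    _                _       = s≤s z≤n
  distPreds-pos (suc m) (node (t ∷ ts)) (s≤s m≤d) = distPredsL-pos m t ts m≤d

  distPredsL-pos : ∀ m t ts → m ≤ depthL (t ∷ ts) → 0 < distPredsL m (t ∷ ts)
  distPredsL-pos m t ts m≤d with ⊔-sel (depth t) (depthL ts)
  ... | inj₁ d≡ = ≤-trans (distPreds-pos m t (subst (m ≤_) d≡ m≤d)) (m≤m+n _ _)
  distPredsL-pos m t [] m≤d       | inj₂ d≡ =
    ≤-trans (distPreds-pos m t (subst (m ≤_) (⊔-identityʳ (depth t)) m≤d)) (m≤m+n _ _)
  distPredsL-pos m t (t′ ∷ ts) m≤d | inj₂ d≡ =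
    ≤-trans (distPredsL-pos m t′ ts (subst (m ≤_) d≡ m≤d)) (m≤n+m _ (distPreds m t))

mutual
  distPreds-vanish : ∀ m t → depth t < m → distPreds m t ≡ 0
  distPreds-vanish (suc m) (node [])       _         = ≡-refl
  distPreds-vanish (suc m) (node (t ∷ ts)) (s≤s d<m) = distPredsL-vanish m (t ∷ ts) d<m

  distPredsL-vanish : ∀ m ts → depthL ts < m → distPredsL m ts ≡ 0
  distPredsL-vanish m []       _   = ≡-refl
  distPredsL-vanish m (t ∷ ts) d<m =
    cong₂ _+_ (distPreds-vanish m t (m⊔n<o⇒m<o (depth t) (depthL ts) d<m))
              (distPredsL-vanish m ts (m⊔n<o⇒n<o (depth t) (depthL ts) d<m))

#≥ : ℕ → List Tree → ℕ
#≥ m []       = 0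
#≥ m (t ∷ ts) with m ≤? depth t
... | yes _ = suc (#≥ m ts)
... | no  _ = #≥ m ts

#≡ : ℕ → List Tree → ℕ
#≡ m []       = 0
#≡ m (t ∷ ts) with depth t ≟ m
... | yes _ = suc (#≡ m ts)
... | no  _ = #≡ m ts

#≥-accept : ∀ m t ts → m ≤ depth t → #≥ m (t ∷ ts) ≡ suc (#≥ m ts)
#≥-accept m t ts m≤d with m ≤? depth t
... | yes _ = ≡-refl
... | no m≰d = ⊥-elim (m≰d m≤d)

#≥-reject : ∀ m t ts → depth t < m → #≥ m (t ∷ ts) ≡ #≥ m ts
#≥-reject m t ts d<m with m ≤? depth t
... | yes m≤d = ⊥-elim (<⇒≱ d<m m≤d)
... | no _    = ≡-refl

#≡-accept : ∀ m t ts → depth t ≡ m → #≡ m (t ∷ ts) ≡ suc (#≡ m ts)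
#≡-accept m t ts d≡m with depth t ≟ m
... | yes _ = ≡-refl
... | no d≢m = ⊥-elim (d≢m d≡m)

#≡-reject : ∀ m t ts → depth t ≢ m → #≡ m (t ∷ ts) ≡ #≡ m ts
#≡-reject m t ts d≢m with depth t ≟ m
... | yes d≡m = ⊥-elim (d≢m d≡m)
... | no _    = ≡-refl

#≡+#≥-suc : ∀ m ts → #≡ m ts + #≥ (suc m) ts ≡ #≥ m ts
#≡+#≥-suc m []       = ≡-refl
#≡+#≥-suc m (t ∷ ts) with <-cmp (depth t) m
... | tri< d<m d≢m _
  rewrite #≡-reject m t ts d≢m | #≥-reject (suc m) t ts (m<n⇒m<1+n d<m)
        | #≥-reject m t ts d<m = #≡+#≥-suc m ts
... | tri≈ _ d≡m _
  rewrite #≡-accept m t ts d≡m | #≥-reject (suc m) t ts (s≤s (≤-reflexive d≡m))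
        | #≥-accept m t ts (≤-reflexive (sym d≡m)) = cong suc (#≡+#≥-suc m ts)
... | tri> _ d≢m m<d
  rewrite #≡-reject m t ts d≢m | #≥-accept (suc m) t ts m<d
        | #≥-accept m t ts (<⇒≤ m<d) = ≡-trans (+-suc _ _) (cong suc (#≡+#≥-suc m ts))

#≥-vanish : ∀ m ts → depthL ts < m → #≥ m ts ≡ 0
#≥-vanish m []       _   = ≡-refl
#≥-vanish m (t ∷ ts) d<m
  rewrite #≥-reject m t ts (m⊔n<o⇒m<o (depth t) (depthL ts) d<m) =
  #≥-vanish m ts (m⊔n<o⇒n<o (depth t) (depthL ts) d<m)

vAt-positive : ∀ {D} (V : Vec ℕ (suc D)) → (∀ i → 1 ≤ lookup V i) → ∀ n → 1 ≤ vAt V n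
vAt-positive (_ ∷ [])    pos _             = pos Fin.zero
vAt-positive (_ ∷ _ ∷ _) pos zero          = pos Fin.zero
vAt-positive (_ ∷ _ ∷ _) pos (suc zero)    = pos Fin.zero
vAt-positive (_ ∷ x ∷ V) pos (suc (suc n)) = vAt-positive (x ∷ V) (λ i → pos (Fin.suc i)) (suc n)

prodV-positive : ∀ {D} (V : Vec ℕ (suc D)) → (∀ i → 1 ≤ lookup V i) → ∀ n → 0 < prodV V n
prodV-positive V pos zero    = s≤s z≤n
prodV-positive V pos (suc n) = *-mono-≤ (prodV-positive V pos n) (vAt-positive V pos (suc n))

module _ {D : ℕ} (V : Vec ℕ (suc D)) where

  Regular-subforest : ∀ {T} ts → (∀ {b} → b ∈V verticesL ts → b ∈V vertices T) →
    Regular V T → All (Regular V) ts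
  Regular-subforest []       _  _   = []
  Regular-subforest (t ∷ ts) ⊆T reg =
    (λ b b∈ → reg b (⊆T (∈V-++ˡ (vertices t) b∈)))
    ∷ Regular-subforest ts (λ b∈ → ⊆T (∈V-++ʳ (vertices t) b∈)) reg

  Regular-children : ∀ {ts} → Regular V (node ts) → All (Regular V) ts
  Regular-children {ts} = Regular-subforest ts there

  Regular⇒distPreds≡prodV : ∀ {t} → Regular V t → ∀ m → m ≤ depth t → distPreds m t ≡ prodV V m
  Regular⇒distPreds≡prodV _ zero _ = ≡-refl
  Regular⇒distPreds≡prodV {t} reg (suc m) m<d with reg t (root∈vertices t) (suc m) (s≤s z≤n)
  ... | inj₁ ≡0 = ⊥-elim (<⇒≢ (distPreds-pos (suc m) t m<d) (sym ≡0))
  ... | inj₂ ≡Π = ≡Π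

  distPredsL-regular : ∀ m ts → All (Regular V) ts → distPredsL m ts ≡ prodV V m * #≥ m ts
  distPredsL-regular m []       []         = sym (*-zeroʳ (prodV V m))
  distPredsL-regular m (t ∷ ts) (reg ∷ regs) with m ≤? depth t
  ... | yes m≤d = begin
    distPreds m t + distPredsL m ts  ≡⟨ cong₂ _+_ (Regular⇒distPreds≡prodV reg m m≤d)
                                                 (distPredsL-regular m ts regs) ⟩
    prodV V m + prodV V m * #≥ m ts  ≡⟨ *-suc (prodV V m) (#≥ m ts) ⟨
    prodV V m * suc (#≥ m ts)        ∎
    where open ≡-Reasoning
  ... | no m≰d = begin
    distPreds m t + distPredsL m ts  ≡⟨ cong (_+ distPredsL m ts) (distPreds-vanish m t (≰⇒> m≰d)) ⟩
    distPredsL m ts                  ≡⟨ distPredsL-regular m ts regs ⟩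
    prodV V m * #≥ m ts              ∎
    where open ≡-Reasoning

  module _ (pos : ∀ i → 1 ≤ lookup V i) {ts : List Tree} (reg : Regular V (node ts)) where

    #≥-regular : ∀ m → m < depth (node ts) → #≥ m ts ≡ vAt V (suc m)
    #≥-regular m m<d with reg (node ts) here (suc m) (s≤s z≤n)
    ... | inj₁ ≡0 = ⊥-elim (<⇒≢ (distPreds-pos (suc m) (node ts) m<d) (sym ≡0))
    ... | inj₂ ≡Π = *-cancelˡ-≡ _ _ (prodV V m) {{>-nonZero (prodV-positive V pos m)}} (begin
      prodV V m * #≥ m ts      ≡⟨ distPredsL-regular m ts (Regular-children reg) ⟨
      distPredsL m ts          ≡⟨ ≡Π ⟩
      prodV V m * vAt V (suc m) ∎)
      where open ≡-Reasoning

    #≡-regular : ∀ m → suc m < depth (node ts) → #≡ m ts ≡ vAt V (suc m) ∸ vAt V (suc (suc m))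
    #≡-regular m m<d = begin
      #≡ m ts                                       ≡⟨ m+n∸n≡m (#≡ m ts) (#≥ (suc m) ts) ⟨
      #≡ m ts + #≥ (suc m) ts ∸ #≥ (suc m) ts       ≡⟨ cong₂ _∸_ (#≡+#≥-suc m ts) (#≥-regular (suc m) m<d) ⟩
      #≥ m ts ∸ vAt V (suc (suc m))                 ≡⟨ cong (_∸ vAt V (suc (suc m))) (#≥-regular m (<⇒≤ m<d)) ⟩
      vAt V (suc m) ∸ vAt V (suc (suc m))           ∎
      where open ≡-Reasoning

    #≡-regular-deepest : depthL ts < depth (node ts) → #≡ (depthL ts) ts ≡ vAt V (suc (depthL ts))
    #≡-regular-deepest K<d = begin
      #≡ K ts                     ≡⟨ +-identityʳ (#≡ K ts) ⟨
      #≡ K ts + 0                 ≡⟨ cong (#≡ K ts +_) (#≥-vanish (suc K) ts ≤-refl) ⟨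
      #≡ K ts + #≥ (suc K) ts     ≡⟨ #≡+#≥-suc K ts ⟩
      #≥ K ts                     ≡⟨ #≥-regular K K<d ⟩
      vAt V (suc K)               ∎
      where open ≡-Reasoning
            K = depthL ts

  modelForest : ℕ → List Tree → List Tree
  modelForest zero    ts = []
  modelForest (suc n) ts = modelForest n ts ++ replicate (#≡ n ts) (TV V n)

  modelForest-[] : ∀ n → modelForest n [] ≡ []
  modelForest-[] zero = ≡-refl
  modelForest-[] (suc n) rewrite modelForest-[] n = ≡-refl

  modelForest-deep : ∀ n t ts → n ≤ depth t → modelForest n (t ∷ ts) ≡ modelForest n ts
  modelForest-deep zero    t ts _   = ≡-refl
  modelForest-deep (suc n) t ts n<d
    rewrite modelForest-deep n t ts (<⇒≤ n<d) | #≡-reject n t ts (>⇒≢ n<d) = ≡-refl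

  modelForest-shallow : ∀ n t ts → depth t < n →
    modelForest n (t ∷ ts) ↭ TV V (depth t) ∷ modelForest n ts
  modelForest-shallow (suc n) t ts (s≤s d≤n) with m≤n⇒m<n∨m≡n d≤n
  ... | inj₁ d<n rewrite #≡-reject n t ts (<⇒≢ d<n) =
    ++⁺ʳ (replicate (#≡ n ts) (TV V n)) (modelForest-shallow n t ts d<n)
  ... | inj₂ d≡n rewrite modelForest-deep n t ts (≤-reflexive (sym d≡n)) | #≡-accept n t ts d≡n | d≡n =
    shift (TV V n) (modelForest n ts) (replicate (#≡ n ts) (TV V n))

  ≅ᶠ-modelForest : ∀ n ts → All (λ t → t ≅ TV V (depth t)) ts → depthL ts < n →
    ts ≅ᶠ modelForest n ts
  ≅ᶠ-modelForest n []       []         _ rewrite modelForest-[] n = ≅ᶠ-[]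
  ≅ᶠ-modelForest n (t ∷ ts) (t≅ ∷ ts≅) d<n =
    ≅ᶠ-↭ (≅ᶠ-∷ t≅ (≅ᶠ-modelForest n ts ts≅ (m⊔n<o⇒n<o (depth t) (depthL ts) d<n)))
         (↭-sym (modelForest-shallow n t ts (m⊔n<o⇒m<o (depth t) (depthL ts) d<n)))

  modelForest≡extra : ∀ n ts → (∀ m → m < n → #≡ m ts ≡ vAt V (suc m) ∸ vAt V (suc (suc m))) →
    modelForest n ts ≡ extra V n
  modelForest≡extra zero    ts _  = ≡-refl
  modelForest≡extra (suc n) ts #≡ₘ
    rewrite modelForest≡extra n ts (λ m m<n → #≡ₘ m (m<n⇒m<1+n m<n)) | #≡ₘ n ≤-refl = ≡-refl

  module _ (pos : ∀ i → 1 ≤ lookup V i) where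

    children-≅ᶠ : ∀ ts → Regular V (node ts) → All (λ t → t ≅ TV V (depth t)) ts →
      depthL ts < depth (node ts) →
      ts ≅ᶠ replicate (vAt V (suc (depthL ts))) (TV V (depthL ts)) ++ extra V (depthL ts)
    children-≅ᶠ ts reg ts≅ K<d =
      ≅ᶠ-↭ (subst (ts ≅ᶠ_) sorted (≅ᶠ-modelForest (suc K) ts ts≅ ≤-refl))
           (++-comm (extra V K) (replicate (vAt V (suc K)) (TV V K)))
      where
      K = depthL ts
      sorted : modelForest (suc K) ts ≡ extra V K ++ replicate (vAt V (suc K)) (TV V K)
      sorted = cong₂ _++_
        (modelForest≡extra K ts (λ m m<K → #≡-regular pos reg m (≤-<-trans m<K K<d)))
        (cong (λ c → replicate c (TV V K)) (#≡-regular-deepest pos reg K<d))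

    mutual
      Regular⇒≅TV : ∀ T → Regular V T → T ≅ TV V (depth T)
      Regular⇒≅TV (node [])       _   = iso refl []
      Regular⇒≅TV (node (t ∷ ts)) reg = node-cong (children-≅ᶠ (t ∷ ts) reg
        (All-Regular⇒≅TV (t ∷ ts) (Regular-children reg)) ≤-refl)

      All-Regular⇒≅TV : ∀ ts → All (Regular V) ts → All (λ t → t ≅ TV V (depth t)) ts
      All-Regular⇒≅TV []       []           = []
      All-Regular⇒≅TV (t ∷ ts) (reg ∷ regs) = Regular⇒≅TV t reg ∷ All-Regular⇒≅TV ts regs

lemma3p2 : (D : ℕ) (V : Vec ℕ (suc D))
    → (∀ (i : Fin (suc D)) → 1 ≤ lookup V i)
    → (∀ (i : Fin D) → lookup V (Fin.suc i) ≤ lookup V (inject₁ i))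
    → (T : Tree) (k : ℕ) → Regular V T → depth T ≡ k
    → T ≅ TV V k
lemma3p2 D V pos _ T _ reg ≡-refl = Regular⇒≅TV V pos T reg
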